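{- Let $\mathfrak M,\mathfrak M'$ be $\omega$-saturated relational pseudo-models and $\mathcal M=\mathcal M(\mathfrak M)=(W,\Sigma,V)$, $\mathcal M'=\mathcal M(\mathfrak M')=(W',\Sigma',V')$. Then for all information states $s\subseteq W$, $s'\subseteq W'$: $\mathcal M{\downarrow},s\equiv^{\mathrm{bulk}}_{\mathsf{InqML}}\mathcal M'{\downarrow},s'$ if and only if $\mathcal M{\downarrow},s\sim\mathcal M'{\downarrow},s'$; and for all worlds $w\in W$, $w'\in W'$: $\mathcal M{\downarrow},w\equiv_{\mathsf{InqML}}\mathcal M'{\downarrow},w'$ if and only if $\mathcal M{\downarrow},w\sim\mathcal M'{\downarrow},w'$.
   Context: Fix an at most countable set of propositional variables $(p_i)_{i\in I}$. A pseudo-model is $\mathcal M=(W,\Sigma,V)$ with $W\neq\emptyset$, $\Sigma\colon W\to\mathcal P(\mathcal P(W))\setminus\{\emptyset\}$, $V\colon\{p_i\}\to\mathcal P(W)$; it is a model if each $\Sigma(w)$ is closed under subsets; $\sigma(w)=\bigcup\Sigma(w)$. Its inquisitive closure is the model $\mathcal M{\downarrow}=(W,\Sigma{\downarrow},V)$ with $\Sigma{\downarrow}(w)=\{t:t\subseteq s\text{ for some }s\in\Sigma(w)\}$. $\mathsf{InqML}$: $\phi::=p_i\mid\bot\mid(\phi\wedge\phi)\mid(\phi\to\phi)\mid(\phi\mathbin{\backslash\!/}\phi)\mid\Box\phi\mid\boxplus\phi$, support semantics on $s\subseteq W$: $p_i$: $s\subseteq V(p_i)$; $\bot$: $s=\emptyset$;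 $\wedge$ componentwise; $\phi\to\psi$: for all $t\subseteq s$, $t\models\phi\Rightarrow t\models\psi$; $\phi\mathbin{\backslash\!/}\psi$: $s\models\phi$ or $s\models\psi$; $\Box\phi$: $\sigma(w)\models\phi$ for all $w\in s$; $\boxplus\phi$: $t\models\phi$ for all $w\in s$, $t\in\Sigma(w)$. Write $\mathcal M,w$ for $\mathcal M,\{w\}$; $\equiv_{\mathsf{InqML}}$ means the same $\mathsf{InqML}$-formulae are supported. Bulk equivalence: $\mathcal M,s\equiv^{\mathrm{bulk}}_{\mathsf{InqML}}\mathcal M',s'$ iff every $w\in s$ has some $w'\in s'$ with $\mathcal M,w\equiv_{\mathsf{InqML}}\mathcal M',w'$ and vice versa. Inquisitive bisimulation between models $\mathcal M,\mathcal M'$: a relation $Z\subseteq W\times W'$ such that for all $(w,w')\in Z$: $w\in V(p_i)\Leftrightarrow w'\in V'(p_i)$ for all $i$; for every $t\in\Sigma(w)$ there is $t'\in\Sigma'(w')$ with $t\,\hat Z\,t'$, and vice versa; here $t\,\hat Z\,t'$ means every $v\in t$ has $v'\in t'$ with $(v,v')\in Z$ and every $v'\in t'$ has $v\in t$ with $(v,v')\in Z$. $\mathcal M,s\sim\mathcal M',s'$ iff $s\,\hat Z\,s'$ for some inquisitive bisimulation $Z$; $\mathcal M,w\sim\mathcal M',w'$ iff $(w,w')\in Z$ for some such $Z$. A relational pseudo-model is a two-sorted first-order structure $\mathfrak M=(W,S,\epsilon,E,(P_i)_{i\in I})$, $\epsilon,E\subseteq W\times S$, $P_i\subseteq W$,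 with extensionality (states with the same $\epsilon$-members are equal) and $E[w]=\{s:(w,s)\in E\}\neq\emptyset$; identify $S\subseteq\mathcal P(W)$, $\epsilon$ as membership. $\mathcal M(\mathfrak M)=(W,w\mapsto E[w],p_i\mapsto P_i)$. $\mathfrak M$ is $\omega$-saturated if it realises every type in finitely many free variables over finitely many parameters consistent with its theory with those parameters. -}

module Defs where

open import Level using (Level; 0ℓ) renaming (suc to lsuc)
open import Data.Nat using (ℕ)
open import Data.Empty using (⊥)
open import Data.Unit using (⊤)
open import Data.Product using (Σ; ∃; _×_; _,_; proj₁; proj₂)
open import Data.Sum using (_⊎_)
open import Data.List using (List; []; _∷_; _++_)
open import Data.List.Relation.Unary.All using (All)
open import Relation.Nullary using (¬_)
open import Relation.Binary.PropositionalEquality using (_≡_)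
open import Function.Bundles using (_⇔_; mk⇔; Equivalence)

Pred₀ : Set → Set₁
Pred₀ W = W → Set

_⊆_ : {W : Set} → Pred₀ W → Pred₀ W → Set
s ⊆ t = ∀ w → s w → t w

_≐_ : {W : Set} → Pred₀ W → Pred₀ W → Set
s ≐ t = (s ⊆ t) × (t ⊆ s)

singleton : {W : Set} → W → Pred₀ W
singleton w = λ v → v ≡ w

record PseudoModel (I : Set) : Set₂ where
  field
    W        : Set
    Sig      : W → Pred₀ W → Set₁
    nonempty : ∀ w → Σ (Pred₀ W) (Sig w)
    V        : I → Pred₀ W
    -- σ(w) = ⋃ Σ(w).  Since Σ(w) is a (large) family of predicates, the
    -- union is recorded as a small predicate together with its defining
    -- property (v ∈ σ(w) iff v ∈ t for some t ∈ Σ(w)).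
    sigma      : W → Pred₀ W
    sigma-spec : ∀ w v → sigma w v ⇔ (Σ (Pred₀ W) λ t → Sig w t × t v)

IsModel : {I : Set} → PseudoModel I → Set₁
IsModel M = ∀ w t u → Sig w t → u ⊆ t → Sig w u
  where open PseudoModel M

closure : {I : Set} → PseudoModel I → PseudoModel I
closure {I} M = record
  { W = W
  ; Sig = λ w t → Σ (Pred₀ W) λ u → Sig w u × (t ⊆ u)
  ; nonempty = λ w → proj₁ (nonempty w) , proj₁ (nonempty w) , proj₂ (nonempty w) , (λ _ x → x)
  ; V = V
  ; sigma = sigma
  ; sigma-spec = λ w v → mk⇔
      (λ x → let (t , σt , tv) = Equivalence.to (sigma-spec w v) x
             in t , (t , σt , (λ _ y → y)) , tv)
      (λ { (t , (u , σu , t⊆u) , tv) → Equivalence.from (sigma-spec w v) (u , σu , t⊆u v tv) })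
  }
  where open PseudoModel M

data InqML (I : Set) : Set where
  atom  : I → InqML I
  bot   : InqML I
  _∧'_  : InqML I → InqML I → InqML I
  _⇒'_  : InqML I → InqML I → InqML I
  _⩔_   : InqML I → InqML I → InqML I
  box   : InqML I → InqML I
  boxplus : InqML I → InqML I

_,_⊨_ : {I : Set} (M : PseudoModel I) → Pred₀ (PseudoModel.W M) → InqML I → Set₁
M , s ⊨ atom i = Level.Lift _ (s ⊆ PseudoModel.V M i)
M , s ⊨ bot = Level.Lift _ (∀ w → ¬ s w)
M , s ⊨ (φ ∧' ψ) = (M , s ⊨ φ) × (M , s ⊨ ψ)
M , s ⊨ (φ ⇒' ψ) = ∀ t → t ⊆ s → M , t ⊨ φ → M , t ⊨ ψ
M , s ⊨ (φ ⩔ ψ) = (M , s ⊨ φ) ⊎ (M , s ⊨ ψ)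
M , s ⊨ box φ = ∀ w → s w → M , PseudoModel.sigma M w ⊨ φ
M , s ⊨ boxplus φ = ∀ w → s w → ∀ t → PseudoModel.Sig M w t → M , t ⊨ φ

InqEquiv : {I : Set} (M M' : PseudoModel I) →
           Pred₀ (PseudoModel.W M) → Pred₀ (PseudoModel.W M') → Set₁
InqEquiv M M' s s' = ∀ φ → (M , s ⊨ φ) ⇔ (M' , s' ⊨ φ)

InqEquivW : {I : Set} (M M' : PseudoModel I) →
            PseudoModel.W M → PseudoModel.W M' → Set₁
InqEquivW M M' w w' = InqEquiv M M' (singleton w) (singleton w')

BulkEquiv : {I : Set} (M M' : PseudoModel I) →
            Pred₀ (PseudoModel.W M) → Pred₀ (PseudoModel.W M') → Set₁
BulkEquiv M M' s s' =
  (∀ w → s w → Σ (PseudoModel.W M') λ w' → s' w' × InqEquivW M M' w w') ×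
  (∀ w' → s' w' → Σ (PseudoModel.W M) λ w → s w × InqEquivW M M' w w')

lift : {W W' : Set} → (W → W' → Set) → Pred₀ W → Pred₀ W' → Set
lift {W} {W'} Z t t' =
  (∀ v → t v → Σ W' λ v' → t' v' × Z v v') ×
  (∀ v' → t' v' → Σ W λ v → t v × Z v v')

IsInqBisim : {I : Set} (M M' : PseudoModel I) →
             (PseudoModel.W M → PseudoModel.W M' → Set) → Set₁
IsInqBisim {I} M M' Z = ∀ w w' → Z w w' →
  (∀ i → (V i w → V' i w') × (V' i w' → V i w)) ×
  (∀ t → Sig w t → Σ (Pred₀ W') λ t' → Sig' w' t' × lift Z t t') ×
  (∀ t' → Sig' w' t' → Σ (Pred₀ W) λ t → Sig w t × lift Z t t')
  where
  open PseudoModel M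
  open PseudoModel M' renaming (W to W'; Sig to Sig'; V to V')

BisimS : {I : Set} (M M' : PseudoModel I) →
         Pred₀ (PseudoModel.W M) → Pred₀ (PseudoModel.W M') → Set₁
BisimS M M' s s' = Σ (PseudoModel.W M → PseudoModel.W M' → Set) λ Z →
  IsInqBisim M M' Z × lift Z s s'

BisimW : {I : Set} (M M' : PseudoModel I) →
         PseudoModel.W M → PseudoModel.W M' → Set₁
BisimW M M' w w' = Σ (PseudoModel.W M → PseudoModel.W M' → Set) λ Z →
  IsInqBisim M M' Z × Z w w'

record RelPseudoModel (I : Set) : Set₁ where
  field
    W S  : Set
    ε E  : W → S → Set
    P    : I → W → Set
    extensional : ∀ s t → (∀ w → (ε w s → ε w t) × (ε w t → ε w s)) → s ≡ t
    E-nonempty  : ∀ w → Σ S (E w)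

toPseudoModel : {I : Set} → RelPseudoModel I → PseudoModel I
toPseudoModel 𝔐 = record
  { W = W
  ; Sig = λ w t → Level.Lift _ (Σ S λ s → E w s × (∀ v → (t v → ε v s) × (ε v s → t v)))
  ; nonempty = λ w → (λ v → ε v (proj₁ (E-nonempty w))) ,
                     Level.lift (proj₁ (E-nonempty w) , proj₂ (E-nonempty w) ,
                                 λ v → (λ x → x) , (λ x → x))
  ; V = P
  ; sigma = λ w v → Σ S λ s → E w s × ε v s
  ; sigma-spec = λ w v → mk⇔
      (λ { (s , ws , vs) → (λ u → ε u s) , Level.lift (s , ws , λ u → (λ x → x) , (λ x → x)) , vs })
      (λ { (t , Level.lift (s , ws , eq) , tv) → s , ws , proj₁ (eq v) tv })
  }
  where open RelPseudoModel 𝔐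

data Sort : Set where
  world state : Sort

data Var : List Sort → Sort → Set where
  here  : ∀ {σ Γ} → Var (σ ∷ Γ) σ
  there : ∀ {σ τ Γ} → Var Γ σ → Var (τ ∷ Γ) σ

data FO (I : Set) : List Sort → Set where
  εᶠ   : ∀ {Γ} → Var Γ world → Var Γ state → FO I Γ
  Eᶠ   : ∀ {Γ} → Var Γ world → Var Γ state → FO I Γ
  Pᶠ   : ∀ {Γ} → I → Var Γ world → FO I Γ
  eqᶠ  : ∀ {Γ σ} → Var Γ σ → Var Γ σ → FO I Γ
  ⊥ᶠ   : ∀ {Γ} → FO I Γ
  _⇒ᶠ_ : ∀ {Γ} → FO I Γ → FO I Γ → FO I Γ
  _∧ᶠ_ : ∀ {Γ} → FO I Γ → FO I Γ → FO I Γ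
  _∨ᶠ_ : ∀ {Γ} → FO I Γ → FO I Γ → FO I Γ
  ∀ᶠ   : ∀ {Γ} σ → FO I (σ ∷ Γ) → FO I Γ
  ∃ᶠ   : ∀ {Γ} σ → FO I (σ ∷ Γ) → FO I Γ

module _ {I : Set} (𝔐 : RelPseudoModel I) where
  open RelPseudoModel 𝔐

  Dom : Sort → Set
  Dom world = W
  Dom state = S

  Env : List Sort → Set
  Env Γ = ∀ {σ} → Var Γ σ → Dom σ

  extend : ∀ {Γ σ} → Env Γ → Dom σ → Env (σ ∷ Γ)
  extend ρ a here = a
  extend ρ a (there x) = ρ x

  appendEnv : ∀ Γ {Δ} → Env Γ → Env Δ → Env (Γ ++ Δ)
  appendEnv [] ρ δ x = δ x
  appendEnv (σ ∷ Γ) ρ δ here = ρ here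
  appendEnv (σ ∷ Γ) ρ δ (there x) = appendEnv Γ (λ y → ρ (there y)) δ x

  Sat : ∀ {Γ} → FO I Γ → Env Γ → Set
  Sat (εᶠ x y) ρ = ε (ρ x) (ρ y)
  Sat (Eᶠ x y) ρ = E (ρ x) (ρ y)
  Sat (Pᶠ i x) ρ = P i (ρ x)
  Sat (eqᶠ x y) ρ = ρ x ≡ ρ y
  Sat ⊥ᶠ ρ = ⊥
  Sat (φ ⇒ᶠ ψ) ρ = Sat φ ρ → Sat ψ ρ
  Sat (φ ∧ᶠ ψ) ρ = Sat φ ρ × Sat ψ ρ
  Sat (φ ∨ᶠ ψ) ρ = Sat φ ρ ⊎ Sat ψ ρ
  Sat (∀ᶠ σ φ) ρ = (a : Dom σ) → Sat φ (extend ρ a)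
  Sat (∃ᶠ σ φ) ρ = Σ (Dom σ) λ a → Sat φ (extend ρ a)

  -- ω-saturation: a type p in the free variables Γ over the finitely many
  -- parameters a (interpreting the context Δ) which is consistent with
  -- Th(𝔐, a), i.e. finitely satisfiable in (𝔐, a), is realised in 𝔐.
  ωSaturated : Set₁
  ωSaturated =
    ∀ (Γ Δ : List Sort) (a : Env Δ) (p : FO I (Γ ++ Δ) → Set) →
    (∀ (fs : List (FO I (Γ ++ Δ))) → All p fs →
       Σ (Env Γ) λ ρ → All (λ φ → Sat φ (appendEnv Γ ρ a)) fs) →
    Σ (Env Γ) λ ρ → ∀ φ → p φ → Sat φ (appendEnv Γ ρ a)

-- Bisimilar states support the same formulae, by induction on the formula.  For the
-- converse, relate worlds that satisfy the same formulae of a flat fragment whose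
-- support at a world is first-order: atoms, ⊥, ¬, ∧ and ⊞(¬g₁ ⩔ … ⩔ ¬gₙ).  Given
-- a successor state s of w, the formulae ∃v ∈ x. g(v) for g witnessed in s are
-- finitely satisfiable by successors x of w' (otherwise w' ⊨ ⊞(¬g₁ ⩔ … ⩔ ¬gₙ),
-- which fails at w), so saturation yields one x witnessing all of them.  For each
-- v ∈ s, the type of v together with "v ∈ x" is finitely satisfiable in x (witness
-- the conjunction), and a realiser is the required bisimilar partner.  Closing
-- the successor states under subsets takes care of the inquisitive closure.

module Submission where

open import Defs
open import Level using (Level; 0ℓ; lower)
import Level
open import Data.Nat using (ℕ)
open import Data.Product using (Σ; _×_; _,_; proj₁; proj₂; swap; map₂)
open import Data.Product.Function.NonDependent.Propositional using (_×-⇔_)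
open import Data.Sum using (_⊎_; inj₁; inj₂)
open import Data.Sum.Function.Propositional using (_⊎-⇔_)
open import Data.List using (List; []; _∷_; _++_; foldr)
open import Data.List.Relation.Unary.All as All using (All; []; _∷_)
open import Data.List.Relation.Unary.All.Properties using (¬Any⇒All¬; All¬⇒¬Any)
open import Data.List.Relation.Unary.Any as Any using (Any)
open import Data.List.Relation.Unary.Any.Properties using (∷↔)
open import Function using (id; _∘_; flip)
open import Function.Bundles using (_⇔_; mk⇔; Equivalence)
open import Function.Construct.Composition using (_⇔-∘_)
open import Function.Construct.Symmetry using (⇔-sym)
open import Function.Definitions using (Injective)
open import Function.Properties.Inverse using (↔⇒⇔)
open import Relation.Nullary using (¬_)
open import Relation.Binary.PropositionalEquality using (_≡_; refl)
open import Axiom.ExcludedMiddle using (ExcludedMiddle)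
open import Axiom.DoubleNegationElimination using (DoubleNegationElimination; em⇒dne)

open Equivalence using (to; from)

private
  variable
    I : Set
    U U' : Set

infix 25 ~_

~_ : InqML I → InqML I
~ φ = φ ⇒' bot

module _ (M : PseudoModel I) where

  ⊨-persistent : ∀ φ {s t} → t ⊆ s → M , s ⊨ φ → M , t ⊨ φ
  ⊨-persistent (atom i)    t⊆s (Level.lift s⊆V)  = Level.lift λ w tw → s⊆V w (t⊆s w tw)
  ⊨-persistent bot         t⊆s (Level.lift s=∅)  = Level.lift λ w tw → s=∅ w (t⊆s w tw)
  ⊨-persistent (φ ∧' ψ)    t⊆s (sφ , sψ)         = ⊨-persistent φ t⊆s sφ , ⊨-persistent ψ t⊆s sψ
  ⊨-persistent (φ ⇒' ψ)    t⊆s s⊨ u u⊆t          = s⊨ u λ w uw → t⊆s w (u⊆t w uw)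
  ⊨-persistent (φ ⩔ ψ)     t⊆s (inj₁ sφ)         = inj₁ (⊨-persistent φ t⊆s sφ)
  ⊨-persistent (φ ⩔ ψ)     t⊆s (inj₂ sψ)         = inj₂ (⊨-persistent ψ t⊆s sψ)
  ⊨-persistent (box φ)     t⊆s s⊨ w tw           = s⊨ w (t⊆s w tw)
  ⊨-persistent (boxplus φ) t⊆s s⊨ w tw           = s⊨ w (t⊆s w tw)

  ⊨~⇔ : ∀ φ {t} → (M , t ⊨ ~ φ) ⇔ (∀ v → t v → ¬ (M , singleton v ⊨ φ))
  ⊨~⇔ φ = mk⇔
    (λ t⊨ v tv v⊨ → lower (t⊨ (singleton v) (λ { _ refl → tv }) v⊨) v refl)
    (λ none u u⊆t u⊨ → Level.lift λ v uv →
       none v (u⊆t v uv) (⊨-persistent φ (λ { _ refl → uv }) u⊨))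

module _ {Z : U → U' → Set} where

  lift-flip : ∀ {t t'} → lift Z t t' → lift (flip Z) t' t
  lift-flip = swap

  lift-map : {Z' : U → U' → Set} → (∀ {v v'} → Z v v' → Z' v v') →
             ∀ {t t'} → lift Z t t' → lift Z' t t'
  lift-map f (forth , back) =
    (λ v tv → map₂ (map₂ f) (forth v tv)) , (λ v' tv' → map₂ (map₂ f) (back v' tv'))

  lift-singleton : ∀ {w w'} → Z w w' → lift Z (singleton w) (singleton w')
  lift-singleton {w} {w'} z = (λ { _ refl → w' , refl , z }) , (λ { _ refl → w , refl , z })

  lift-restrictʳ : ∀ {t t' u'} → lift Z t t' → u' ⊆ t' →
                   Σ (Pred₀ U) λ u → u ⊆ t × lift Z u u'
  lift-restrictʳ {t} {u' = u'} (_ , back) u'⊆t' =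
    (λ v → t v × Σ U' λ v' → u' v' × Z v v') ,
    (λ _ → proj₁) ,
    (λ v (_ , v' , u'v' , z) → v' , u'v' , z) ,
    (λ v' u'v' → let (v , tv , z) = back v' (u'⊆t' v' u'v') in v , (tv , v' , u'v' , z) , z)

module _ {M M' : PseudoModel I} {Z : PseudoModel.W M → PseudoModel.W M' → Set} where
  open PseudoModel using (sigma; sigma-spec)

  IsInqBisim-flip : IsInqBisim M M' Z → IsInqBisim M' M (flip Z)
  IsInqBisim-flip B w' w z =
    let (atoms , forth , back) = B w w' z in
    (λ i → swap (atoms i)) ,
    (λ t' t'∈ → map₂ (map₂ lift-flip) (back t' t'∈)) ,
    (λ t t∈ → map₂ (map₂ lift-flip) (forth t t∈))

  sigma-forth : IsInqBisim M M' Z → ∀ {w w'} → Z w w' →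
                ∀ v → sigma M w v → Σ (PseudoModel.W M') λ v' → sigma M' w' v' × Z v v'
  sigma-forth B {w} {w'} z v wv =
    let (t , t∈ , tv) = to (sigma-spec M w v) wv
        (t' , t'∈ , forth , _) = proj₁ (proj₂ (B w w' z)) t t∈
        (v' , t'v' , zv) = forth v tv
    in v' , from (sigma-spec M' w' v') (t' , t'∈ , t'v') , zv

lift-sigma : {M M' : PseudoModel I} {Z : PseudoModel.W M → PseudoModel.W M' → Set} →
             IsInqBisim M M' Z → ∀ {w w'} → Z w w' →
             lift Z (PseudoModel.sigma M w) (PseudoModel.sigma M' w')
lift-sigma {M = M} {M'} B z =
  sigma-forth {M = M} {M'} B z , sigma-forth {M = M'} {M} (IsInqBisim-flip {M = M} {M'} B) z

⊨-bisim : {M M' : PseudoModel I} {Z : PseudoModel.W M → PseudoModel.W M' → Set} →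
          IsInqBisim M M' Z → ∀ φ {t t'} → lift Z t t' → M , t ⊨ φ → M' , t' ⊨ φ
⊨-bisim B (atom i) (_ , back) (Level.lift t⊆V) = Level.lift λ v' t'v' →
  let (v , tv , z) = back v' t'v' in proj₁ (proj₁ (B v v' z) i) (t⊆V v tv)
⊨-bisim B bot (_ , back) (Level.lift t=∅) = Level.lift λ v' t'v' →
  let (v , tv , _) = back v' t'v' in t=∅ v tv
⊨-bisim B (φ ∧' ψ) L (tφ , tψ) = ⊨-bisim B φ L tφ , ⊨-bisim B ψ L tψ
⊨-bisim {M = M} {M'} B (φ ⇒' ψ) L t⊨ u' u'⊆t' u'φ =
  let (u , u⊆t , Lu) = lift-restrictʳ L u'⊆t' in
  ⊨-bisim B ψ Lu (t⊨ u u⊆t (⊨-bisim (IsInqBisim-flip {M = M} {M'} B) φ (lift-flip Lu) u'φ))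
⊨-bisim B (φ ⩔ ψ) L (inj₁ tφ) = inj₁ (⊨-bisim B φ L tφ)
⊨-bisim B (φ ⩔ ψ) L (inj₂ tψ) = inj₂ (⊨-bisim B ψ L tψ)
⊨-bisim {M = M} {M'} B (box φ) (_ , back) t⊨ w' t'w' =
  let (w , tw , z) = back w' t'w' in ⊨-bisim B φ (lift-sigma {M = M} {M'} B z) (t⊨ w tw)
⊨-bisim B (boxplus φ) (_ , back) t⊨ w' t'w' T' T'∈ =
  let (w , tw , z) = back w' t'w'
      (T , T∈ , LT) = proj₂ (proj₂ (B w w' z)) T' T'∈
  in ⊨-bisim B φ LT (t⊨ w tw T T∈)

bisim⇒InqEquivW : {M M' : PseudoModel I} {Z : PseudoModel.W M → PseudoModel.W M' → Set} →
                  IsInqBisim M M' Z → ∀ {w w'} → Z w w' → InqEquivW M M' w w'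
bisim⇒InqEquivW {M = M} {M'} B z φ = mk⇔
  (⊨-bisim B φ (lift-singleton z))
  (⊨-bisim (IsInqBisim-flip {M = M} {M'} B) φ (lift-flip (lift-singleton z)))

-- ⊞¬ g gs encodes ⊞(¬g ⩔ ¬g₁ ⩔ … ⩔ ¬gₙ) for gs = g₁ ∷ … ∷ gₙ.
data Flat (I : Set) : Set where
  var    : I → Flat I
  falsum : Flat I
  not    : Flat I → Flat I
  _and_  : Flat I → Flat I → Flat I
  ⊞¬     : Flat I → List (Flat I) → Flat I

conj : List (Flat I) → Flat I
conj = foldr _and_ (not falsum)

mutual
  ⟦_⟧ : Flat I → InqML I
  ⟦ var i ⟧    = atom i
  ⟦ falsum ⟧   = bot
  ⟦ not g ⟧    = ~ ⟦ g ⟧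
  ⟦ g and h ⟧  = ⟦ g ⟧ ∧' ⟦ h ⟧
  ⟦ ⊞¬ g gs ⟧  = boxplus (⩔~ g gs)

  ⩔~ : Flat I → List (Flat I) → InqML I
  ⩔~ g []       = ~ ⟦ g ⟧
  ⩔~ g (h ∷ hs) = ~ ⟦ g ⟧ ⩔ ⩔~ h hs

mutual
  ST : ∀ {Γ} → Flat I → FO I (world ∷ Γ)
  ST (var i)   = Pᶠ i here
  ST falsum    = ⊥ᶠ
  ST (not g)   = ST g ⇒ᶠ ⊥ᶠ
  ST (g and h) = ST g ∧ᶠ ST h
  ST (⊞¬ g gs) = ∀ᶠ state (Eᶠ (there here) here ⇒ᶠ ST-⩔none g gs)

  ST-none : ∀ {Γ} → Flat I → FO I (state ∷ Γ)
  ST-none g = ∀ᶠ world (εᶠ here (there here) ⇒ᶠ (ST g ⇒ᶠ ⊥ᶠ))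

  ST-⩔none : ∀ {Γ} → Flat I → List (Flat I) → FO I (state ∷ Γ)
  ST-⩔none g []       = ST-none g
  ST-⩔none g (h ∷ hs) = ST-none g ∨ᶠ ST-⩔none h hs

hasMemberᶠ : ∀ {Γ} → Flat I → FO I (state ∷ Γ)
hasMemberᶠ g = ∃ᶠ world (εᶠ here (there here) ∧ᶠ ST g)

𝓜↓ : RelPseudoModel I → PseudoModel I
𝓜↓ 𝔐 = closure (toPseudoModel 𝔐)

env₁ : (𝔐 : RelPseudoModel I) → ∀ {σ} → Dom 𝔐 σ → Env 𝔐 (σ ∷ [])
env₁ 𝔐 a = extend 𝔐 (λ ()) a

-- Truth of flat formulae is first-order satisfaction rather than InqML support, so that
-- FlatEquiv below is a small relation, as IsInqBisim requires.
_,_⊨ᶠ_ : (𝔐 : RelPseudoModel I) → RelPseudoModel.W 𝔐 → Flat I → Set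
𝔐 , w ⊨ᶠ g = Sat 𝔐 (ST g) (env₁ 𝔐 w)

Witnessed : (𝔐 : RelPseudoModel I) → RelPseudoModel.S 𝔐 → Flat I → Set
Witnessed 𝔐 x g = Σ (RelPseudoModel.W 𝔐) λ v → RelPseudoModel.ε 𝔐 v x × (𝔐 , v ⊨ᶠ g)

Refuted : (𝔐 : RelPseudoModel I) → RelPseudoModel.S 𝔐 → Flat I → Set
Refuted 𝔐 x g = ∀ v → RelPseudoModel.ε 𝔐 v x → ¬ (𝔐 , v ⊨ᶠ g)

FlatEquiv : (𝔐 𝔐' : RelPseudoModel I) → RelPseudoModel.W 𝔐 → RelPseudoModel.W 𝔐' → Set
FlatEquiv 𝔐 𝔐' w w' = ∀ g → (𝔐 , w ⊨ᶠ g) ⇔ (𝔐' , w' ⊨ᶠ g)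

FlatEquiv-sym : ∀ {𝔐 𝔐' : RelPseudoModel I} {w w'} → FlatEquiv 𝔐 𝔐' w w' → FlatEquiv 𝔐' 𝔐 w' w
FlatEquiv-sym w≡w' g = ⇔-sym (w≡w' g)

module _ (𝔐 : RelPseudoModel I) where
  open RelPseudoModel 𝔐
  open PseudoModel (𝓜↓ 𝔐) using (Sig)

  members : S → Pred₀ W
  members x v = ε v x

  ⊆members⇒Σ↓ : ∀ {w x t} → E w x → t ⊆ members x → Sig w t
  ⊆members⇒Σ↓ {x = x} wx t⊆x = members x , Level.lift (x , wx , λ _ → id , id) , t⊆x

  Σ↓⇒⊆members : ∀ {w t} → Sig w t → Σ S λ x → E w x × t ⊆ members x
  Σ↓⇒⊆members (u , Level.lift (x , wx , u≐x) , t⊆u) = x , wx , λ v tv → proj₁ (u≐x v) (t⊆u v tv)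

  mutual
    ST-correct : ∀ {Γ} g (e : Env 𝔐 (world ∷ Γ)) →
                 Sat 𝔐 (ST g) e ⇔ (𝓜↓ 𝔐 , singleton (e here) ⊨ ⟦ g ⟧)
    ST-correct (var i) e = mk⇔ (λ p → Level.lift λ { _ refl → p }) (λ h → lower h _ refl)
    ST-correct falsum e = mk⇔ (λ ()) (λ h → lower h _ refl)
    ST-correct (not g) e = mk⇔
      (λ ¬st → from (⊨~⇔ (𝓜↓ 𝔐) ⟦ g ⟧) λ { _ refl v⊨ → ¬st (from (ST-correct g e) v⊨) })
      (λ e⊨ st → to (⊨~⇔ (𝓜↓ 𝔐) ⟦ g ⟧) e⊨ _ refl (to (ST-correct g e) st))
    ST-correct (g and h) e = ST-correct g e ×-⇔ ST-correct h e
    ST-correct (⊞¬ g gs) e = mk⇔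
      (λ { st _ refl t t∈ →
         let (x , wx , t⊆x) = Σ↓⇒⊆members t∈ in
         ⊨-persistent (𝓜↓ 𝔐) (⩔~ g gs) t⊆x (to (ST-⩔none-correct g gs (extend 𝔐 e x)) (st x wx)) })
      (λ e⊨ x wx →
         from (ST-⩔none-correct g gs (extend 𝔐 e x)) (e⊨ _ refl (members x) (⊆members⇒Σ↓ wx λ _ → id)))

    ST-none-correct : ∀ {Γ} g (e : Env 𝔐 (state ∷ Γ)) →
                      Sat 𝔐 (ST-none g) e ⇔ (𝓜↓ 𝔐 , members (e here) ⊨ ~ ⟦ g ⟧)
    ST-none-correct g e = mk⇔
      (λ st → from (⊨~⇔ (𝓜↓ 𝔐) ⟦ g ⟧) λ v xv v⊨ → st v xv (from (ST-correct g (extend 𝔐 e v)) v⊨))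
      (λ x⊨ v xv st → to (⊨~⇔ (𝓜↓ 𝔐) ⟦ g ⟧) x⊨ v xv (to (ST-correct g (extend 𝔐 e v)) st))

    ST-⩔none-correct : ∀ {Γ} g gs (e : Env 𝔐 (state ∷ Γ)) →
                       Sat 𝔐 (ST-⩔none g gs) e ⇔ (𝓜↓ 𝔐 , members (e here) ⊨ ⩔~ g gs)
    ST-⩔none-correct g []       e = ST-none-correct g e
    ST-⩔none-correct g (h ∷ hs) e = ST-none-correct g e ⊎-⇔ ST-⩔none-correct h hs e

  ST⇔⊨ᶠ : ∀ {Γ} g (e : Env 𝔐 (world ∷ Γ)) → Sat 𝔐 (ST g) e ⇔ (𝔐 , e here ⊨ᶠ g)
  ST⇔⊨ᶠ g e = ⇔-sym (ST-correct g (env₁ 𝔐 (e here))) ⇔-∘ ST-correct g e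

  hasMember⇔Witnessed : ∀ {Γ} g (e : Env 𝔐 (state ∷ Γ)) →
                        Sat 𝔐 (hasMemberᶠ g) e ⇔ Witnessed 𝔐 (e here) g
  hasMember⇔Witnessed g e = mk⇔
    (λ (v , xv , st) → v , xv , to (ST⇔⊨ᶠ g (extend 𝔐 e v)) st)
    (λ (v , xv , v⊨) → v , xv , from (ST⇔⊨ᶠ g (extend 𝔐 e v)) v⊨)

  ST-none⇔Refuted : ∀ {Γ} g (e : Env 𝔐 (state ∷ Γ)) → Sat 𝔐 (ST-none g) e ⇔ Refuted 𝔐 (e here) g
  ST-none⇔Refuted g e = mk⇔
    (λ st v xv v⊨ → st v xv (from (ST⇔⊨ᶠ g (extend 𝔐 e v)) v⊨))
    (λ ref v xv st → ref v xv (to (ST⇔⊨ᶠ g (extend 𝔐 e v)) st))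

  ST-⩔none⇔Any : ∀ {Γ} g gs (e : Env 𝔐 (state ∷ Γ)) →
                 Sat 𝔐 (ST-⩔none g gs) e ⇔ Any (Refuted 𝔐 (e here)) (g ∷ gs)
  ST-⩔none⇔Any g [] e =
    mk⇔ (Any.here ∘ to (ST-none⇔Refuted g e)) λ { (Any.here ref) → from (ST-none⇔Refuted g e) ref ; (Any.there ()) }
  ST-⩔none⇔Any g (h ∷ hs) e =
    ↔⇒⇔ (∷↔ _) ⇔-∘ (ST-none⇔Refuted g e ⊎-⇔ ST-⩔none⇔Any h hs e)

  ⊨ᶠ-conj⇔All : ∀ {w} gs → (𝔐 , w ⊨ᶠ conj gs) ⇔ All (λ g → 𝔐 , w ⊨ᶠ g) gs
  ⊨ᶠ-conj⇔All []       = mk⇔ (λ _ → []) (λ _ ⊥ → ⊥)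
  ⊨ᶠ-conj⇔All (g ∷ gs) = mk⇔
    (λ (w⊨g , w⊨gs) → w⊨g ∷ to (⊨ᶠ-conj⇔All gs) w⊨gs)
    (λ { (w⊨g ∷ w⊨gs) → w⊨g , from (⊨ᶠ-conj⇔All gs) w⊨gs })

  witnessing-successor⇒⊭⊞¬ : ∀ {w x} g gs → E w x → All (Witnessed 𝔐 x) (g ∷ gs) →
                              ¬ (𝔐 , w ⊨ᶠ ⊞¬ g gs)
  witnessing-successor⇒⊭⊞¬ {w} {x} g gs wx wit w⊨ =
    All¬⇒¬Any (All.map (λ (v , xv , v⊨) ref → ref v xv v⊨) wit)
              (to (ST-⩔none⇔Any g gs (extend 𝔐 (env₁ 𝔐 w) x)) (w⊨ x wx))

  module _ (dne : DoubleNegationElimination 0ℓ) where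

    ¬Refuted⇒Witnessed : ∀ {x g} → ¬ Refuted 𝔐 x g → Witnessed 𝔐 x g
    ¬Refuted⇒Witnessed ¬ref = dne λ ¬wit → ¬ref λ v xv v⊨ → ¬wit (v , xv , v⊨)

    ⊭⊞¬⇒witnessing-successor : ∀ {w} g gs → ¬ (𝔐 , w ⊨ᶠ ⊞¬ g gs) →
                                Σ S λ x → E w x × All (Witnessed 𝔐 x) (g ∷ gs)
    ⊭⊞¬⇒witnessing-successor {w} g gs w⊭ = dne λ none → w⊭ λ x wx → dne λ ¬st →
      none (x , wx , All.map (λ {g} → ¬Refuted⇒Witnessed {x} {g})
        (¬Any⇒All¬ (g ∷ gs) (¬st ∘ from (ST-⩔none⇔Any g gs (extend 𝔐 (env₁ 𝔐 w) x)))))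

module _ (𝔐 : RelPseudoModel I) (sat : ωSaturated 𝔐) where

  realise-family :
    ∀ Γ {Δ} (a : Env 𝔐 Δ) {A : Set} (φ₀ : FO I (Γ ++ Δ)) (F : A → FO I (Γ ++ Δ)) (P : A → Set) →
    (∀ as → All P as →
       Σ (Env 𝔐 Γ) λ ρ → Sat 𝔐 φ₀ (appendEnv 𝔐 Γ ρ a) × All (λ α → Sat 𝔐 (F α) (appendEnv 𝔐 Γ ρ a)) as) →
    Σ (Env 𝔐 Γ) λ ρ → Sat 𝔐 φ₀ (appendEnv 𝔐 Γ ρ a) × (∀ α → P α → Sat 𝔐 (F α) (appendEnv 𝔐 Γ ρ a))
  realise-family Γ {Δ} a {A} φ₀ F P finite =
    proj₁ realised , proj₂ realised φ₀ (inj₁ refl) , λ α Pα → proj₂ realised (F α) (inj₂ (α , Pα , refl))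
    where
    type : FO I (Γ ++ Δ) → Set
    type φ = φ ≡ φ₀ ⊎ Σ A λ α → P α × φ ≡ F α

    indices : ∀ {φs} → All type φs → List A
    indices []                       = []
    indices (inj₁ _ ∷ ts)            = indices ts
    indices (inj₂ (α , _ , _) ∷ ts)  = α ∷ indices ts

    indices-P : ∀ {φs} (ts : All type φs) → All P (indices ts)
    indices-P []                      = []
    indices-P (inj₁ _ ∷ ts)           = indices-P ts
    indices-P (inj₂ (_ , Pα , _) ∷ ts) = Pα ∷ indices-P ts

    satisfies : ∀ {ρ : Env 𝔐 (Γ ++ Δ)} {φs} (ts : All type φs) → Sat 𝔐 φ₀ ρ → All (λ α → Sat 𝔐 (F α) ρ) (indices ts) →
                All (λ φ → Sat 𝔐 φ ρ) φs
    satisfies []                         _   _           = []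
    satisfies (inj₁ refl ∷ ts)           ⊨φ₀ ⊨Fs         = ⊨φ₀ ∷ satisfies ts ⊨φ₀ ⊨Fs
    satisfies (inj₂ (_ , _ , refl) ∷ ts) ⊨φ₀ (⊨Fα ∷ ⊨Fs) = ⊨Fα ∷ satisfies ts ⊨φ₀ ⊨Fs

    finitely-satisfiable : ∀ φs → All type φs →
                           Σ (Env 𝔐 Γ) λ ρ → All (λ φ → Sat 𝔐 φ (appendEnv 𝔐 Γ ρ a)) φs
    finitely-satisfiable φs ts =
      let r = finite (indices ts) (indices-P ts) in proj₁ r , satisfies ts (proj₁ (proj₂ r)) (proj₂ (proj₂ r))

    realised : Σ (Env 𝔐 Γ) λ ρ → ∀ φ → type φ → Sat 𝔐 φ (appendEnv 𝔐 Γ ρ a)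
    realised = sat Γ Δ a type finitely-satisfiable

module _ (dne : DoubleNegationElimination 0ℓ)
         (𝔐 𝔐' : RelPseudoModel I) (sat' : ωSaturated 𝔐') where
  open RelPseudoModel 𝔐
  open RelPseudoModel 𝔐' using () renaming (W to W'; S to S'; ε to ε'; E to E'; E-nonempty to E'-nonempty)

  witnessing-match : ∀ {w w' s} → FlatEquiv 𝔐 𝔐' w w' → E w s →
                     Σ S' λ x → E' w' x × (∀ g → Witnessed 𝔐 s g → Witnessed 𝔐' x g)
  witnessing-match {w} {w'} {s} w≡w' ws =
    let r = realise-family 𝔐' sat' (state ∷ []) (env₁ 𝔐' w')
              (Eᶠ (there here) here) hasMemberᶠ (Witnessed 𝔐 s) finite
    in proj₁ r here , proj₁ (proj₂ r) , λ g s-wit → to (hasMember⇔Witnessed 𝔐' g _) (proj₂ (proj₂ r) g s-wit)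
    where
    finite : ∀ gs → All (Witnessed 𝔐 s) gs →
             Σ (Env 𝔐' (state ∷ [])) λ ρ →
               E' w' (ρ here) × All (λ g → Sat 𝔐' (hasMemberᶠ g) (appendEnv 𝔐' (state ∷ []) ρ (env₁ 𝔐' w'))) gs
    finite [] [] = env₁ 𝔐' (proj₁ (E'-nonempty w')) , proj₂ (E'-nonempty w') , []
    finite (g ∷ gs) s-wit =
      let (x , w'x , x-wit) = ⊭⊞¬⇒witnessing-successor 𝔐' dne g gs λ w'⊨ →
            witnessing-successor⇒⊭⊞¬ 𝔐 g gs ws s-wit (from (w≡w' (⊞¬ g gs)) w'⊨)
      in env₁ 𝔐' x , w'x , All.map (λ {g} → from (hasMember⇔Witnessed 𝔐' g _)) x-wit

  member-match : ∀ {s x v} → (∀ g → Witnessed 𝔐 s g → Witnessed 𝔐' x g) → ε v s →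
                 Σ W' λ v' → ε' v' x × FlatEquiv 𝔐 𝔐' v v'
  member-match {s} {x} {v} wit⊆ vs = v' , v'x , λ g → mk⇔ (forth g) (back g)
    where
    finite : ∀ gs → All (λ g → 𝔐 , v ⊨ᶠ g) gs →
             Σ (Env 𝔐' (world ∷ [])) λ ρ →
               ε' (ρ here) x × All (λ g → Sat 𝔐' (ST g) (appendEnv 𝔐' (world ∷ []) ρ (env₁ 𝔐' x))) gs
    finite gs v⊨gs =
      let (u , ux , u⊨) = wit⊆ (conj gs) (v , vs , from (⊨ᶠ-conj⇔All 𝔐 gs) v⊨gs) in
      env₁ 𝔐' u , ux , All.map (λ {g} → from (ST⇔⊨ᶠ 𝔐' g _)) (to (⊨ᶠ-conj⇔All 𝔐' gs) u⊨)

    realised : Σ (Env 𝔐' (world ∷ [])) λ ρ →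
                 ε' (ρ here) x × (∀ g → 𝔐 , v ⊨ᶠ g → Sat 𝔐' (ST g) (appendEnv 𝔐' (world ∷ []) ρ (env₁ 𝔐' x)))
    realised = realise-family 𝔐' sat' (world ∷ []) (env₁ 𝔐' x)
                 (εᶠ here (there here)) ST (λ g → 𝔐 , v ⊨ᶠ g) finite

    v' : W'
    v' = proj₁ realised here

    v'x : ε' v' x
    v'x = proj₁ (proj₂ realised)

    forth : ∀ g → 𝔐 , v ⊨ᶠ g → 𝔐' , v' ⊨ᶠ g
    forth g v⊨ = to (ST⇔⊨ᶠ 𝔐' g _) (proj₂ (proj₂ realised) g v⊨)

    back : ∀ g → 𝔐' , v' ⊨ᶠ g → 𝔐 , v ⊨ᶠ g
    back g v'⊨ = dne λ v⊭ → forth (not g) v⊭ v'⊨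

  FlatEquiv-forth : ∀ {w w' t} → FlatEquiv 𝔐 𝔐' w w' → PseudoModel.Sig (𝓜↓ 𝔐) w t →
                    Σ (Pred₀ W') λ t' → PseudoModel.Sig (𝓜↓ 𝔐') w' t' × lift (FlatEquiv 𝔐 𝔐') t t'
  FlatEquiv-forth {t = t} w≡w' t∈ =
    let (s , ws , t⊆s) = Σ↓⇒⊆members 𝔐 t∈
        (x , w'x , wit⊆) = witnessing-match w≡w' ws
    in (λ v' → ε' v' x × Σ W λ v → t v × FlatEquiv 𝔐 𝔐' v v') ,
       ⊆members⇒Σ↓ 𝔐' w'x (λ _ → proj₁) ,
       (λ v tv → let (v' , v'x , v≡v') = member-match wit⊆ (t⊆s v tv) in v' , (v'x , v , tv , v≡v') , v≡v') ,
       (λ v' (_ , v , tv , v≡v') → v , tv , v≡v')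

FlatEquiv-isInqBisim : DoubleNegationElimination 0ℓ → (𝔐 𝔐' : RelPseudoModel I) →
                       ωSaturated 𝔐 → ωSaturated 𝔐' → IsInqBisim (𝓜↓ 𝔐) (𝓜↓ 𝔐') (FlatEquiv 𝔐 𝔐')
FlatEquiv-isInqBisim dne 𝔐 𝔐' sat sat' w w' w≡w' =
  (λ i → to (w≡w' (var i)) , from (w≡w' (var i))) ,
  (λ t t∈ → FlatEquiv-forth dne 𝔐 𝔐' sat' w≡w' t∈) ,
  (λ t' t'∈ → map₂ (map₂ (lift-map FlatEquiv-sym ∘ lift-flip))
                   (FlatEquiv-forth dne 𝔐' 𝔐 sat (FlatEquiv-sym w≡w') t'∈))

InqEquivW⇒FlatEquiv : ∀ {𝔐 𝔐' : RelPseudoModel I} {w w'} →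
                      InqEquivW (𝓜↓ 𝔐) (𝓜↓ 𝔐') w w' → FlatEquiv 𝔐 𝔐' w w'
InqEquivW⇒FlatEquiv {𝔐 = 𝔐} {𝔐'} {w} {w'} w≡w' g =
  ⇔-sym (ST-correct 𝔐' g (env₁ 𝔐' w')) ⇔-∘ (w≡w' ⟦ g ⟧ ⇔-∘ ST-correct 𝔐 g (env₁ 𝔐 w))

corollary5p6 :
    -- classical metatheory (the paper's ambient logic)
    (∀ {ℓ : Level} → ExcludedMiddle ℓ) →
    -- an at most countable set of propositional variables
    (I : Set) (ι : I → ℕ) → Injective _≡_ _≡_ ι →
    (𝔐 𝔐' : RelPseudoModel I) → ωSaturated 𝔐 → ωSaturated 𝔐' →
    ((s : Pred₀ (RelPseudoModel.W 𝔐)) (s' : Pred₀ (RelPseudoModel.W 𝔐')) →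
       BulkEquiv (closure (toPseudoModel 𝔐)) (closure (toPseudoModel 𝔐')) s s'
       ⇔ BisimS (closure (toPseudoModel 𝔐)) (closure (toPseudoModel 𝔐')) s s')
    ×
    ((w : RelPseudoModel.W 𝔐) (w' : RelPseudoModel.W 𝔐') →
       InqEquivW (closure (toPseudoModel 𝔐)) (closure (toPseudoModel 𝔐')) w w'
       ⇔ BisimW (closure (toPseudoModel 𝔐)) (closure (toPseudoModel 𝔐')) w w')
corollary5p6 em I _ _ 𝔐 𝔐' sat sat' =
  (λ s s' → mk⇔
     (λ (forth , back) → FlatEquiv 𝔐 𝔐' , bisim ,
        (λ w sw → map₂ (map₂ InqEquivW⇒FlatEquiv) (forth w sw)) ,
        (λ w' sw' → map₂ (map₂ InqEquivW⇒FlatEquiv) (back w' sw')))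
     (λ (Z , B , forth , back) →
        (λ w sw → map₂ (map₂ (bisim⇒InqEquivW B)) (forth w sw)) ,
        (λ w' sw' → map₂ (map₂ (bisim⇒InqEquivW B)) (back w' sw')))) ,
  (λ w w' → mk⇔
     (λ w≡w' → FlatEquiv 𝔐 𝔐' , bisim , InqEquivW⇒FlatEquiv w≡w')
     (λ (Z , B , z) → bisim⇒InqEquivW B z))
  where
  bisim : IsInqBisim (𝓜↓ 𝔐) (𝓜↓ 𝔐') (FlatEquiv 𝔐 𝔐')
  bisim = FlatEquiv-isInqBisim (em⇒dne em) 𝔐 𝔐' sat sat'
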